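{- There exists a non-empty subset $A\subseteq\mathbb{Z}$ such that $A$ has a minimal complement in $\mathbb{Z}$, but $A$ is not a minimal complement to any subset of $\mathbb{Z}$. Thus $A$ belongs to a minimal pair, but does not belong to any co-minimal pair.
   Context: For non-empty subsets $A,B\subseteq\mathbb{Z}$: $(A,B)$ is a complement pair if $A+B=\mathbb{Z}$; $A$ is a minimal complement of $B$ if $A+B=\mathbb{Z}$ and $(A\setminus\{a\})+B\neq\mathbb{Z}$ for all $a\in A$. A minimal pair is a complement pair in which at least one of the two sets is a minimal complement of the other. A co-minimal pair is a pair $(A,B)$ with $A$ a minimal complement of $B$ and $B$ a minimal complement of $A$. -}

module Defs where

open import Level using (0ℓ)
open import Data.Integer using (ℤ; _+_)
open import Data.Product using (Σ; ∃; _×_)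
open import Relation.Nullary using (¬_)
open import Relation.Unary using (Pred)
open import Relation.Binary.PropositionalEquality using (_≡_)

Subset : Set₁
Subset = Pred ℤ 0ℓ

NonEmpty : Subset → Set
NonEmpty A = ∃ λ a → A a

_⊕_ : Subset → Subset → Subset
(A ⊕ B) n = ∃ λ a → ∃ λ b → A a × B b × n ≡ a + b

Covers : Subset → Set
Covers S = ∀ n → S n

ComplementPair : Subset → Subset → Set
ComplementPair A B = Covers (A ⊕ B)

Remove : Subset → ℤ → Subset
Remove A a x = A x × ¬ (x ≡ a)

IsMinimalComplement : Subset → Subset → Set
IsMinimalComplement A B =
  ComplementPair A B × (∀ a → A a → ¬ Covers (Remove A a ⊕ B))

-- ℤ ∖ {0} has the minimal complement {0, 1}: both elements are needed, since {b} + ℤ ∖ {0}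
-- misses b. Yet ℤ ∖ {0} is a minimal complement of nothing: if ℤ ∖ {0} + C = ℤ then C contains
-- some b and b + d with d ≠ 0, and ℤ ∖ {0, a} + {b, b + d} = ℤ already holds whenever {0, a}
-- is disjoint from its translate by -d, i.e. whenever a ∉ {0, d, -d}.
module Submission where

open import Defs
open import Algebra.Bundles using (AbelianGroup)
open import Data.Empty using (⊥-elim)
open import Data.Integer using (ℤ; _+_; _-_; +_; ∣_∣; 0ℤ; 1ℤ; -1ℤ; _≟_)
open import Data.Integer.Properties using (+-identityˡ; +-0-abelianGroup; ∣-i∣≡∣i∣)
open import Data.Integer.Tactic.RingSolver using (solve-∀)
open import Data.Nat using (suc)
open import Data.Nat.Properties using (1+n≢n)
open import Data.Product using (∃; _×_; _,_)
open import Data.Sum using (_⊎_; inj₁; inj₂)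
open import Function using (_∘_)
open import Relation.Nullary using (¬_; yes; no)
open import Relation.Unary using (｛_｝; _∪_; _⊆_)
open import Relation.Binary.PropositionalEquality
  using (_≡_; _≢_; refl; sym; trans; cong; subst)
open import Algebra.Properties.Group (AbelianGroup.group +-0-abelianGroup)
  using (identityʳ-unique; inverseˡ-unique)

Punctured : Subset
Punctured x = x ≢ 0ℤ

ZeroOne : Subset
ZeroOne = ｛ 0ℤ ｝ ∪ ｛ 1ℤ ｝

⊕-monoˡ : ∀ {A A′ B : Subset} → A ⊆ A′ → A ⊕ B ⊆ A′ ⊕ B
⊕-monoˡ A⊆A′ (a , b , Aa , Bb , n≡a+b) = a , b , A⊆A′ Aa , Bb , n≡a+b

Remove-∪ˡ : ∀ {x} {P : Subset} → Remove (｛ x ｝ ∪ P) x ⊆ P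
Remove-∪ˡ (inj₁ x≡y , y≢x) = ⊥-elim (y≢x (sym x≡y))
Remove-∪ˡ (inj₂ Py  , _)   = Py

Remove-∪ʳ : ∀ {x} {P : Subset} → Remove (P ∪ ｛ x ｝) x ⊆ P
Remove-∪ʳ (inj₁ Py  , _)   = Py
Remove-∪ʳ (inj₂ x≡y , y≢x) = ⊥-elim (y≢x (sym x≡y))

covers-⊕-translatePair : ∀ {A B : Subset} {b d} →
  (∀ m → A m ⊎ A (m + d)) → B (d + b) → B b → Covers (A ⊕ B)
covers-⊕-translatePair {b = b} {d} A∪A-d B[d+b] Bb n with A∪A-d (n - (d + b))
... | inj₁ Am   = n - (d + b) , d + b , Am , B[d+b] , split n (d + b)
  where
  split : ∀ n c → n ≡ (n - c) + c
  split = solve-∀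
... | inj₂ Am+d = n - (d + b) + d , b , Am+d , Bb , split n d b
  where
  split : ∀ n d b → n ≡ (n - (d + b) + d) + b
  split = solve-∀

∉-⊕-Punctured : ∀ b → ¬ (｛ b ｝ ⊕ Punctured) b
∉-⊕-Punctured b (b′ , a , b≡b′ , a≢0 , b≡b′+a) =
  a≢0 (identityʳ-unique b a (trans (cong (_+ a) b≡b′) (sym b≡b′+a)))

ZeroOne-complements-Punctured : ComplementPair ZeroOne Punctured
ZeroOne-complements-Punctured n with n ≟ 0ℤ
... | yes n≡0 = 1ℤ , -1ℤ , inj₂ refl , (λ ()) , n≡0
... | no  n≢0 = 0ℤ , n , inj₁ refl , n≢0 , sym (+-identityˡ n)

ZeroOne-minimalComplement-Punctured : IsMinimalComplement ZeroOne Punctured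
ZeroOne-minimalComplement-Punctured = ZeroOne-complements-Punctured , minimal
  where
  minimal : ∀ b → ZeroOne b → ¬ Covers (Remove ZeroOne b ⊕ Punctured)
  minimal b (inj₁ refl) covers = ∉-⊕-Punctured 1ℤ (⊕-monoˡ (Remove-∪ˡ {P = ｛ 1ℤ ｝}) (covers 1ℤ))
  minimal b (inj₂ refl) covers = ∉-⊕-Punctured 0ℤ (⊕-monoˡ (Remove-∪ʳ {P = ｛ 0ℤ ｝}) (covers 0ℤ))

avoid-0-±d : ∀ d → ∃ λ a → a ≢ 0ℤ × a ≢ d × a + d ≢ 0ℤ
avoid-0-±d d = + suc ∣ d ∣ , (λ ()) , a≢d , a+d≢0
  where
  a≢d : + suc ∣ d ∣ ≢ d
  a≢d a≡d = 1+n≢n (cong ∣_∣ a≡d)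

  a+d≢0 : + suc ∣ d ∣ + d ≢ 0ℤ
  a+d≢0 a+d≡0 = 1+n≢n (trans (cong ∣_∣ (inverseˡ-unique (+ suc ∣ d ∣) d a+d≡0)) (∣-i∣≡∣i∣ d))

Remove-Punctured-∪-translate : ∀ {a d} → d ≢ 0ℤ → a ≢ 0ℤ → a ≢ d → a + d ≢ 0ℤ →
  ∀ m → Remove Punctured a m ⊎ Remove Punctured a (m + d)
Remove-Punctured-∪-translate {a} {d} d≢0 a≢0 a≢d a+d≢0 m with m ≟ 0ℤ | m ≟ a
... | no m≢0 | no m≢a = inj₁ (m≢0 , m≢a)
... | yes refl | _    = inj₂ (subst (Remove Punctured a) (sym (+-identityˡ d)) (d≢0 , a≢d ∘ sym))
... | no _ | yes refl = inj₂ (a+d≢0 , λ a+d≡a → d≢0 (identityʳ-unique a d a+d≡a))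

Punctured-notMinimalComplement : ∀ (C : Subset) → NonEmpty C → ¬ IsMinimalComplement Punctured C
Punctured-notMinimalComplement C (c , Cc) (covers , minimal) with covers c
... | d , c′ , d≢0 , Cc′ , c≡d+c′ with avoid-0-±d d
... | a , a≢0 , a≢d , a+d≢0 =
  minimal a a≢0
    (covers-⊕-translatePair (Remove-Punctured-∪-translate d≢0 a≢0 a≢d a+d≢0) (subst C c≡d+c′ Cc) Cc′)

lemma2p1 : ∃ λ (A : Subset) →
    NonEmpty A
    × (∃ λ (B : Subset) → NonEmpty B × IsMinimalComplement B A)
    × (∀ (C : Subset) → NonEmpty C → ¬ IsMinimalComplement A C)
lemma2p1 =
  Punctured , (1ℤ , λ ())
  , (ZeroOne , (0ℤ , inj₁ refl) , ZeroOne-minimalComplement-Punctured)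
  , Punctured-notMinimalComplement
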